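{- Let $A\ge1$, $n\ge0$, $\sigma\ge0$ be integers and let $P_j(z;q)=\sum_{t=0}^n p_{j,t}(q)z^t$ ($j=1,\dots,A$) be polynomials in $z$ of degree at most $n$ with coefficients $p_{j,t}(q)\in\mathbb{Q}(q)$. Define $$R(s;q)=\sum_{j=1}^A\sum_{t=0}^n\frac{q^t p_{j,t}(q)}{(1-sq^t)^j},\qquad \Pi(s;q)=(s;q)_{n+1}^A\,R(s;q).$$ Then there exists a polynomial $\overline{P}_0(z;q)$ of degree at most $n$ with coefficients in $\mathbb{Q}(q)$ such that $$\overline{P}_0(z;q)+\sum_{j=1}^A P_j(z;q)\operatorname{Li}_j(z;1/q)=\mathcal{O}(z^{\sigma+n+1})\quad\text{as } z\to0$$ if and only if $(sq^{n+1};q)_\sigma=\prod_{i=n+1}^{n+\sigma}(1-sq^{i})$ divides $\Pi(s;q)$.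
   Context: $q$ is a complex number with $0<|q|<1$, $q\notin\mathbb{R}_-$. $(\alpha;q)_m=(1-\alpha)(1-\alpha q)\cdots(1-\alpha q^{m-1})$, $(\alpha;q)_0=1$. $\operatorname{Li}_j(z;1/q)=\sum_{k\ge1}\frac{q^{ -k}}{(1-q^{ -k})^j}z^k$, a power series in $z$ near $0$; the $\mathcal{O}(z^{\sigma+n+1})$ condition means the resulting power series in $z$ contains only powers $z^k$ with $k\ge\sigma+n+1$. -}

module Defs where

open import Level using (Level; _⊔_) renaming (suc to lsuc)
open import Algebra.Bundles using (CommutativeRing)
open import Data.Nat as ℕ using (ℕ; zero; suc; _<_; _<?_; _∸_; _≡ᵇ_; _<ᵇ_)
open import Data.Fin as Fin using (Fin; toℕ; fromℕ<)
open import Data.Bool using (if_then_else_)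
open import Data.List using (List; []; _∷_)
open import Data.Product using (Σ; Σ-syntax; _×_)
open import Relation.Nullary using (¬_; yes; no)

-- Fields: a commutative ring with 1 ≉ 0 and a (total) inverse operation
-- which is a genuine multiplicative inverse on every nonzero element.
-- (The value of 0⁻¹ is unconstrained and never used below.)

record Field (c ℓ : Level) : Set (lsuc (c ⊔ ℓ)) where
  field
    commutativeRing : CommutativeRing c ℓ
  open CommutativeRing commutativeRing public
  field
    _⁻¹      : Carrier → Carrier
    ⁻¹-inverse : ∀ x → ¬ (x ≈ 0#) → x * (x ⁻¹) ≈ 1#
    1≉0      : ¬ (1# ≈ 0#)

module FieldOps {c ℓ : Level} (K : Field c ℓ) where
  open Field K

  infixl 6 _−_
  _−_ : Carrier → Carrier → Carrier
  x − y = x + (- y)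

  infixr 8 _^_
  _^_ : Carrier → ℕ → Carrier
  x ^ zero  = 1#
  x ^ suc m = x * (x ^ m)

  ofℕ : ℕ → Carrier
  ofℕ zero    = 0#
  ofℕ (suc m) = 1# + ofℕ m

  CharZero : Set ℓ
  CharZero = ∀ m → ¬ (ofℕ (suc m) ≈ 0#)

  NotRootOfUnity : Carrier → Set ℓ
  NotRootOfUnity q = ∀ m → ¬ ((q ^ suc m) ≈ 1#)

  ∑ : (m : ℕ) → (Fin m → Carrier) → Carrier
  ∑ zero    f = 0#
  ∑ (suc m) f = f Fin.zero + ∑ m (λ i → f (Fin.suc i))

  -- Polynomials over K, as coefficient lists (constant term first).

  Poly : Set c
  Poly = List Carrier

  coeff : Poly → ℕ → Carrier
  coeff []       _       = 0#
  coeff (a ∷ p)  zero    = a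
  coeff (a ∷ p)  (suc i) = coeff p i

  _≋_ : Poly → Poly → Set ℓ
  p ≋ r = ∀ i → coeff p i ≈ coeff r i

  infixl 6 _+ₚ_
  _+ₚ_ : Poly → Poly → Poly
  []      +ₚ r       = r
  (a ∷ p) +ₚ []      = a ∷ p
  (a ∷ p) +ₚ (b ∷ r) = (a + b) ∷ (p +ₚ r)

  scale : Carrier → Poly → Poly
  scale a []      = []
  scale a (b ∷ p) = (a * b) ∷ scale a p

  infixl 7 _*ₚ_
  _*ₚ_ : Poly → Poly → Poly
  []      *ₚ r = []
  (a ∷ p) *ₚ r = scale a r +ₚ (0# ∷ (p *ₚ r))

  const : Carrier → Poly
  const a = a ∷ []

  oneₚ : Poly
  oneₚ = const 1#

  infixr 8 _^ₚ_
  _^ₚ_ : Poly → ℕ → Poly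
  p ^ₚ zero  = oneₚ
  p ^ₚ suc m = p *ₚ (p ^ₚ m)

  ∑ₚ : (m : ℕ) → (Fin m → Poly) → Poly
  ∑ₚ zero    f = []
  ∑ₚ (suc m) f = f Fin.zero +ₚ ∑ₚ m (λ i → f (Fin.suc i))

  ∏ₚ : (m : ℕ) → (Fin m → Poly) → Poly
  ∏ₚ zero    f = oneₚ
  ∏ₚ (suc m) f = f Fin.zero *ₚ ∏ₚ m (λ i → f (Fin.suc i))

  _∣ₚ_ : Poly → Poly → Set (c ⊔ ℓ)
  d ∣ₚ p = Σ[ r ∈ Poly ] (d *ₚ r) ≋ p

  1−_s : Carrier → Poly
  1− a s = 1# ∷ (- a) ∷ []

-- The objects of the lemma.  Data: A ≥ 1 written as A = suc A′ (so the
-- index j ∈ {1,…,A} is represented by J : Fin A with j = toℕ J + 1),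
-- n, and coefficients p J t = p_{j,t}(q) for t = 0,…,n.

module Lemma2Defs {c ℓ : Level} (K : Field c ℓ) (q : Field.Carrier K) where
  open Field K
  open FieldOps K

  -- coefficient of z^m (m ≥ 1) in Li_j(z;1/q) = ∑_{k≥1} q^{-k}/(1-q^{-k})^j z^k
  liCoeff : (j : ℕ) → (m : ℕ) → Carrier
  liCoeff j zero    = 0#
  liCoeff j (suc m) =
    ((q ⁻¹) ^ suc m) * (((1# − ((q ⁻¹) ^ suc m)) ⁻¹) ^ j)

  jOf : {A : ℕ} → Fin A → ℕ
  jOf J = suc (toℕ J)

  coeffFin : (n : ℕ) → (Fin (suc n) → Carrier) → ℕ → Carrier
  coeffFin n P k with k <? suc n
  ... | yes k<n+1 = P (fromℕ< k<n+1)
  ... | no  _     = 0#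

  -- coefficient of z^k in  ∑_{j=1}^A P_j(z;q) Li_j(z;1/q)
  -- (the term t contributes p_{j,t} times the coefficient of z^{k-t} of Li_j,
  --  which is 0 unless k - t ≥ 1)
  sumPLiCoeff : (A n : ℕ) → (Fin A → Fin (suc n) → Carrier) → ℕ → Carrier
  sumPLiCoeff A n p k =
    ∑ A (λ J → ∑ (suc n) (λ t →
      if toℕ t <ᵇ k then p J t * liCoeff (jOf J) (k ∸ toℕ t) else 0#))

  -- Π(s;q) = (s;q)_{n+1}^A R(s;q) written out as the polynomial in s
  --   ∑_{j=1}^A ∑_{t=0}^n q^t p_{j,t} (1 − s q^t)^{A−j} ∏_{0≤i≤n, i≠t} (1 − s q^i)^A
  Π : (A n : ℕ) → (Fin A → Fin (suc n) → Carrier) → Poly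
  Π A n p =
    ∑ₚ A (λ J → ∑ₚ (suc n) (λ t →
      scale ((q ^ toℕ t) * p J t)
        (((1− (q ^ toℕ t) s) ^ₚ (A ∸ jOf J)) *ₚ
         ∏ₚ (suc n) (λ i →
           if toℕ i ≡ᵇ toℕ t then oneₚ else ((1− (q ^ toℕ i) s) ^ₚ A)))))

  shiftedPoch : (n σ : ℕ) → Poly
  shiftedPoch n σ = ∏ₚ σ (λ i → 1− (q ^ (suc n ℕ.+ toℕ i)) s)

-- For k > n, expanding Li_j(z;1/q) = ∑_m q^{-m} (1 − q^{-m})^{-j} z^m shows that the coefficient
-- of z^k in ∑_j P_j(z;q) Li_j(z;1/q) is q^{-k} R(q^{-k};q), and (q^{-k};q)_{n+1}^A ≠ 0, so this
-- coefficient vanishes iff Π(q^{-k};q) = 0.  The coefficients of z^0,…,z^n can always be cancelled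
-- by P̄₀, so the condition says exactly that q^{-(n+1)},…,q^{-(n+σ)} are roots of Π.  These are the
-- roots of the factors 1 − s q^{n+1},…,1 − s q^{n+σ}, pairwise distinct as q is not a root of
-- unity, and the factor theorem turns the roots into divisibility by (s q^{n+1};q)_σ.
module Submission where

open import Defs
open import Level using (Level)
open import Data.Nat as ℕ using (ℕ; suc; _<_)
open import Data.Fin using (Fin)
open import Data.Product using (Σ-syntax)
open import Function.Bundles using (_⇔_)
open import Relation.Nullary using (¬_)

open import Data.Nat using (zero; _∸_; _<?_)
import Data.Nat.Properties as ℕₚ
import Data.Fin as Fin
import Data.Fin.Properties as Finₚ
open import Data.Bool using (true; false; if_then_else_)
open import Data.Empty using (⊥-elim)
open import Data.List using ([]; _∷_; drop)
open import Data.Product using (_,_; proj₁; proj₂)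
open import Function.Bundles using (mk⇔; Equivalence)
import Function.Properties.Equivalence as ⇔
open import Relation.Nullary using (yes; no)
open import Relation.Binary.PropositionalEquality as ≡ using (_≡_)

σ+n+1≡suc[n]+σ : ∀ n σ → σ ℕ.+ n ℕ.+ 1 ≡ suc n ℕ.+ σ
σ+n+1≡suc[n]+σ n σ = ≡.trans (ℕₚ.+-comm (σ ℕ.+ n) 1) (≡.cong suc (ℕₚ.+-comm σ n))

suc[n]+i<σ+n+1 : ∀ n σ (i : Fin σ) → suc n ℕ.+ Fin.toℕ i < σ ℕ.+ n ℕ.+ 1
suc[n]+i<σ+n+1 n σ i =
  ≡.subst (suc n ℕ.+ Fin.toℕ i <_) (≡.sym (σ+n+1≡suc[n]+σ n σ))
    (ℕₚ.+-monoʳ-< (suc n) (Finₚ.toℕ<n i))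

n<k<σ+n+1⇒k≡suc[n]+i : ∀ n σ {k} → n < k → k < σ ℕ.+ n ℕ.+ 1 →
  Σ[ i ∈ Fin σ ] suc n ℕ.+ Fin.toℕ i ≡ k
n<k<σ+n+1⇒k≡suc[n]+i n σ n<k k<σ+n+1 with ℕₚ.m≤n⇒∃[o]m+o≡n n<k
... | o , ≡.refl = Fin.fromℕ< o<σ , ≡.cong (suc n ℕ.+_) (Finₚ.toℕ-fromℕ< o<σ)
  where
  o<σ : o < σ
  o<σ = ℕₚ.+-cancelˡ-< (suc n) o σ (≡.subst (suc n ℕ.+ o <_) (σ+n+1≡suc[n]+σ n σ) k<σ+n+1)

module FieldProperties {c ℓ : Level} (K : Field c ℓ) where
  open Field K hiding (zero)
  open FieldOps K
  open import Algebra.Properties.Ring ring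
    using (x∙y⁻¹≈ε⇒x≈y; -‿distribˡ-*; -‿distribʳ-*; -‿involutive)
  open import Relation.Binary.Reasoning.Setoid setoid

  x*y≈0⇒y≈0 : ∀ {x y} → ¬ x ≈ 0# → x * y ≈ 0# → y ≈ 0#
  x*y≈0⇒y≈0 {x} {y} x≉0 xy≈0 = begin
    y                ≈⟨ *-identityˡ y ⟨
    1# * y           ≈⟨ *-congʳ (⁻¹-inverse x x≉0) ⟨
    (x * x ⁻¹) * y   ≈⟨ *-congʳ (*-comm x (x ⁻¹)) ⟩
    (x ⁻¹ * x) * y   ≈⟨ *-assoc (x ⁻¹) x y ⟩
    x ⁻¹ * (x * y)   ≈⟨ *-congˡ xy≈0 ⟩
    x ⁻¹ * 0#        ≈⟨ zeroʳ (x ⁻¹) ⟩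
    0#               ∎

  x≈z*y⇒[x≈0⇔y≈0] : ∀ {x y z} → ¬ z ≈ 0# → x ≈ z * y → (x ≈ 0#) ⇔ (y ≈ 0#)
  x≈z*y⇒[x≈0⇔y≈0] {z = z} z≉0 x≈zy = mk⇔
    (λ x≈0 → x*y≈0⇒y≈0 z≉0 (trans (sym x≈zy) x≈0))
    (λ y≈0 → trans x≈zy (trans (*-congˡ y≈0) (zeroʳ z)))

  x≉0∧y≉0⇒x*y≉0 : ∀ {x y} → ¬ x ≈ 0# → ¬ y ≈ 0# → ¬ x * y ≈ 0#
  x≉0∧y≉0⇒x*y≉0 x≉0 y≉0 xy≈0 = y≉0 (x*y≈0⇒y≈0 x≉0 xy≈0)

  x≉0⇒x^n≉0 : ∀ {x} n → ¬ x ≈ 0# → ¬ x ^ n ≈ 0#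
  x≉0⇒x^n≉0 zero    x≉0 = 1≉0
  x≉0⇒x^n≉0 (suc n)   x≉0 = x≉0∧y≉0⇒x*y≉0 x≉0 (x≉0⇒x^n≉0 n x≉0)

  x≉0⇒x⁻¹≉0 : ∀ {x} → ¬ x ≈ 0# → ¬ x ⁻¹ ≈ 0#
  x≉0⇒x⁻¹≉0 {x} x≉0 x⁻¹≈0 =
    1≉0 (trans (sym (⁻¹-inverse x x≉0)) (trans (*-congˡ x⁻¹≈0) (zeroʳ x)))

  1−x≈0⇒x≈1 : ∀ {x} → 1# − x ≈ 0# → x ≈ 1#
  1−x≈0⇒x≈1 {x} e = sym (x∙y⁻¹≈ε⇒x≈y 1# x e)

  -x*-y≈x*y : ∀ x y → - x * - y ≈ x * y
  -x*-y≈x*y x y = begin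
    - x * - y      ≈⟨ -‿distribˡ-* x (- y) ⟨
    - (x * - y)    ≈⟨ -‿cong (-‿distribʳ-* x y) ⟨
    - - (x * y)    ≈⟨ -‿involutive (x * y) ⟩
    x * y          ∎

  ^-congˡ : ∀ {x y} n → x ≈ y → x ^ n ≈ y ^ n
  ^-congˡ zero  x≈y = refl
  ^-congˡ (suc n) x≈y = *-cong x≈y (^-congˡ n x≈y)

  ^-homo-* : ∀ x m n → x ^ (m ℕ.+ n) ≈ x ^ m * x ^ n
  ^-homo-* x zero  n = sym (*-identityˡ _)
  ^-homo-* x (suc m) n = trans (*-congˡ (^-homo-* x m n)) (sym (*-assoc _ _ _))

  ^-distrib-* : ∀ x y n → (x * y) ^ n ≈ x ^ n * y ^ n
  ^-distrib-* x y zero  = sym (*-identityˡ 1#)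
  ^-distrib-* x y (suc n) =
    trans (*-congˡ (^-distrib-* x y n)) (interchange x y (x ^ n) (y ^ n))
    where open import Algebra.Properties.CommutativeSemigroup *-commutativeSemigroup using (interchange)

  1^n≈1 : ∀ n → 1# ^ n ≈ 1#
  1^n≈1 zero  = refl
  1^n≈1 (suc n) = trans (*-identityˡ _) (1^n≈1 n)

  x^n*x⁻¹^n≈1 : ∀ {x} n → ¬ x ≈ 0# → x ^ n * x ⁻¹ ^ n ≈ 1#
  x^n*x⁻¹^n≈1 {x} n x≉0 = begin
    x ^ n * x ⁻¹ ^ n  ≈⟨ ^-distrib-* x (x ⁻¹) n ⟨
    (x * x ⁻¹) ^ n    ≈⟨ ^-congˡ n (⁻¹-inverse x x≉0) ⟩
    1# ^ n            ≈⟨ 1^n≈1 n ⟩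
    1#                ∎

  ∑-cong : ∀ m {f g : Fin m → Carrier} → (∀ i → f i ≈ g i) → ∑ m f ≈ ∑ m g
  ∑-cong zero  f≈g = refl
  ∑-cong (suc m) f≈g = +-cong (f≈g Fin.zero) (∑-cong m (λ i → f≈g (Fin.suc i)))

  *-distribˡ-∑ : ∀ m a (f : Fin m → Carrier) → a * ∑ m f ≈ ∑ m (λ i → a * f i)
  *-distribˡ-∑ zero  a f = zeroʳ a
  *-distribˡ-∑ (suc m) a f = trans (distribˡ a _ _) (+-congˡ (*-distribˡ-∑ m a _))

  ∏ : (m : ℕ) → (Fin m → Carrier) → Carrier
  ∏ zero  f = 1#
  ∏ (suc m) f = f Fin.zero * ∏ m (λ i → f (Fin.suc i))

  ∏-cong : ∀ m {f g : Fin m → Carrier} → (∀ i → f i ≈ g i) → ∏ m f ≈ ∏ m g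
  ∏-cong zero  f≈g = refl
  ∏-cong (suc m) f≈g = *-cong (f≈g Fin.zero) (∏-cong m (λ i → f≈g (Fin.suc i)))

  ∏-≈0 : ∀ m (f : Fin m → Carrier) i → f i ≈ 0# → ∏ m f ≈ 0#
  ∏-≈0 (suc m) f Fin.zero    fi≈0 = trans (*-congʳ fi≈0) (zeroˡ _)
  ∏-≈0 (suc m) f (Fin.suc i) fi≈0 = trans (*-congˡ (∏-≈0 m _ i fi≈0)) (zeroʳ _)

  ∏-≉0 : ∀ m (f : Fin m → Carrier) → (∀ i → ¬ f i ≈ 0#) → ¬ ∏ m f ≈ 0#
  ∏-≉0 zero  f f≉0 = 1≉0
  ∏-≉0 (suc m) f f≉0 =
    x≉0∧y≉0⇒x*y≉0 (f≉0 Fin.zero) (∏-≉0 m _ (λ i → f≉0 (Fin.suc i)))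

  ∏-punctured : ∀ m (f : Fin m → Carrier) t →
    ∏ m (λ i → if Fin.toℕ i ℕ.≡ᵇ Fin.toℕ t then 1# else f i) * f t ≈ ∏ m f
  ∏-punctured (suc m) f Fin.zero    = trans (*-congʳ (*-identityˡ _)) (*-comm _ _)
  ∏-punctured (suc m) f (Fin.suc t) =
    trans (*-assoc _ _ _) (*-congˡ (∏-punctured m (λ i → f (Fin.suc i)) t))

module Polynomials {c ℓ : Level} (K : Field c ℓ) where
  open Field K hiding (zero)
  open FieldOps K
  open FieldProperties K
  open import Algebra.Properties.Ring ring
    using (-‿distribˡ-*; -‿distribʳ-*; +-inverseˡ-unique)
  open import Relation.Binary.Reasoning.Setoid setoid
  open import Algebra.Solver.Ring.NaturalCoefficients.Default commutativeSemiring

  coeff-+ₚ : ∀ p r i → coeff (p +ₚ r) i ≈ coeff p i + coeff r i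
  coeff-+ₚ []      r       i       = sym (+-identityˡ _)
  coeff-+ₚ (a ∷ p) []      i       = sym (+-identityʳ _)
  coeff-+ₚ (a ∷ p) (b ∷ r) zero  = refl
  coeff-+ₚ (a ∷ p) (b ∷ r) (suc i) = coeff-+ₚ p r i

  coeff-scale : ∀ a p i → coeff (scale a p) i ≈ a * coeff p i
  coeff-scale a []      i       = sym (zeroʳ a)
  coeff-scale a (b ∷ p) zero  = refl
  coeff-scale a (b ∷ p) (suc i) = coeff-scale a p i

  coeff-0∷[] : ∀ i → coeff (0# ∷ []) i ≈ 0#
  coeff-0∷[] zero  = refl
  coeff-0∷[] (suc i) = refl

  0∷-cong : ∀ p r → p ≋ r → (0# ∷ p) ≋ (0# ∷ r)
  0∷-cong p r p≋r zero  = refl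
  0∷-cong p r p≋r (suc i) = p≋r i

  +ₚ-cong : ∀ p p′ r r′ → p ≋ p′ → r ≋ r′ → (p +ₚ r) ≋ (p′ +ₚ r′)
  +ₚ-cong p p′ r r′ p≋p′ r≋r′ i =
    trans (coeff-+ₚ p r i) (trans (+-cong (p≋p′ i) (r≋r′ i)) (sym (coeff-+ₚ p′ r′ i)))

  scale-cong : ∀ a r r′ → r ≋ r′ → scale a r ≋ scale a r′
  scale-cong a r r′ r≋r′ i =
    trans (coeff-scale a r i) (trans (*-congˡ (r≋r′ i)) (sym (coeff-scale a r′ i)))

  *ₚ-congˡ : ∀ p r r′ → r ≋ r′ → (p *ₚ r) ≋ (p *ₚ r′)
  *ₚ-congˡ []      r r′ r≋r′ i = refl
  *ₚ-congˡ (a ∷ p) r r′ r≋r′   =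
    +ₚ-cong (scale a r) (scale a r′) (0# ∷ (p *ₚ r)) (0# ∷ (p *ₚ r′))
      (scale-cong a r r′ r≋r′) (0∷-cong (p *ₚ r) (p *ₚ r′) (*ₚ-congˡ p r r′ r≋r′))

  *ₚ-identityˡ : ∀ p → (oneₚ *ₚ p) ≋ p
  *ₚ-identityˡ p i = begin
    coeff (scale 1# p +ₚ (0# ∷ [])) i   ≈⟨ coeff-+ₚ (scale 1# p) (0# ∷ []) i ⟩
    coeff (scale 1# p) i + coeff (0# ∷ []) i ≈⟨ +-cong (coeff-scale 1# p i) (coeff-0∷[] i) ⟩
    1# * coeff p i + 0#                 ≈⟨ +-identityʳ _ ⟩
    1# * coeff p i                      ≈⟨ *-identityˡ _ ⟩
    coeff p i                           ∎

  scale-*ₚ : ∀ a p r → (scale a p *ₚ r) ≋ scale a (p *ₚ r)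
  scale-*ₚ a []      r i = refl
  scale-*ₚ a (b ∷ p) r i = begin
    coeff (scale (a * b) r +ₚ (0# ∷ (scale a p *ₚ r))) i
      ≈⟨ coeff-+ₚ (scale (a * b) r) _ i ⟩
    coeff (scale (a * b) r) i + coeff (0# ∷ (scale a p *ₚ r)) i
      ≈⟨ +-cong (trans (coeff-scale (a * b) r i) (*-assoc a b _)) (tail i) ⟩
    a * (b * coeff r i) + a * coeff (0# ∷ (p *ₚ r)) i
      ≈⟨ distribˡ a _ _ ⟨
    a * (b * coeff r i + coeff (0# ∷ (p *ₚ r)) i)
      ≈⟨ *-congˡ (+-congʳ (coeff-scale b r i)) ⟨
    a * (coeff (scale b r) i + coeff (0# ∷ (p *ₚ r)) i)
      ≈⟨ *-congˡ (coeff-+ₚ (scale b r) _ i) ⟨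
    a * coeff ((b ∷ p) *ₚ r) i
      ≈⟨ coeff-scale a ((b ∷ p) *ₚ r) i ⟨
    coeff (scale a ((b ∷ p) *ₚ r)) i ∎
    where
    tail : ∀ i → coeff (0# ∷ (scale a p *ₚ r)) i ≈ a * coeff (0# ∷ (p *ₚ r)) i
    tail zero  = sym (zeroʳ a)
    tail (suc i) = trans (scale-*ₚ a p r i) (coeff-scale a (p *ₚ r) i)

  *ₚ-distribʳ-+ₚ : ∀ p p′ r → ((p +ₚ p′) *ₚ r) ≋ ((p *ₚ r) +ₚ (p′ *ₚ r))
  *ₚ-distribʳ-+ₚ []      p′       r i = refl
  *ₚ-distribʳ-+ₚ (a ∷ p) []       r i = sym (trans (coeff-+ₚ ((a ∷ p) *ₚ r) [] i) (+-identityʳ _))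
  *ₚ-distribʳ-+ₚ (a ∷ p) (b ∷ p′) r i = begin
    coeff (scale (a + b) r +ₚ (0# ∷ ((p +ₚ p′) *ₚ r))) i
      ≈⟨ coeff-+ₚ (scale (a + b) r) _ i ⟩
    coeff (scale (a + b) r) i + coeff (0# ∷ ((p +ₚ p′) *ₚ r)) i
      ≈⟨ +-cong (coeff-scale (a + b) r i) (tail i) ⟩
    (a + b) * coeff r i + (coeff (0# ∷ (p *ₚ r)) i + coeff (0# ∷ (p′ *ₚ r)) i)
      ≈⟨ regroup a b (coeff r i) _ _ ⟩
    (a * coeff r i + coeff (0# ∷ (p *ₚ r)) i) + (b * coeff r i + coeff (0# ∷ (p′ *ₚ r)) i)
      ≈⟨ +-cong (+-congʳ (coeff-scale a r i)) (+-congʳ (coeff-scale b r i)) ⟨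
    (coeff (scale a r) i + coeff (0# ∷ (p *ₚ r)) i) + (coeff (scale b r) i + coeff (0# ∷ (p′ *ₚ r)) i)
      ≈⟨ +-cong (coeff-+ₚ (scale a r) _ i) (coeff-+ₚ (scale b r) _ i) ⟨
    coeff ((a ∷ p) *ₚ r) i + coeff ((b ∷ p′) *ₚ r) i
      ≈⟨ coeff-+ₚ ((a ∷ p) *ₚ r) ((b ∷ p′) *ₚ r) i ⟨
    coeff (((a ∷ p) *ₚ r) +ₚ ((b ∷ p′) *ₚ r)) i ∎
    where
    regroup : ∀ a b x u v → (a + b) * x + (u + v) ≈ (a * x + u) + (b * x + v)
    regroup = solve 5 (λ a b x u v → (a :+ b) :* x :+ (u :+ v) := (a :* x :+ u) :+ (b :* x :+ v)) refl
    tail : ∀ i → coeff (0# ∷ ((p +ₚ p′) *ₚ r)) i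
               ≈ coeff (0# ∷ (p *ₚ r)) i + coeff (0# ∷ (p′ *ₚ r)) i
    tail zero  = sym (+-identityˡ 0#)
    tail (suc i) = trans (*ₚ-distribʳ-+ₚ p p′ r i) (coeff-+ₚ (p *ₚ r) (p′ *ₚ r) i)

  0∷-*ₚ : ∀ p r → ((0# ∷ p) *ₚ r) ≋ (0# ∷ (p *ₚ r))
  0∷-*ₚ p r i = begin
    coeff (scale 0# r +ₚ (0# ∷ (p *ₚ r))) i          ≈⟨ coeff-+ₚ (scale 0# r) _ i ⟩
    coeff (scale 0# r) i + coeff (0# ∷ (p *ₚ r)) i   ≈⟨ +-congʳ (trans (coeff-scale 0# r i) (zeroˡ _)) ⟩
    0# + coeff (0# ∷ (p *ₚ r)) i                     ≈⟨ +-identityˡ _ ⟩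
    coeff (0# ∷ (p *ₚ r)) i                          ∎

  *ₚ-assoc : ∀ p r t → ((p *ₚ r) *ₚ t) ≋ (p *ₚ (r *ₚ t))
  *ₚ-assoc []      r t i = refl
  *ₚ-assoc (a ∷ p) r t i =
    trans (*ₚ-distribʳ-+ₚ (scale a r) (0# ∷ (p *ₚ r)) t i)
      (+ₚ-cong (scale a r *ₚ t) (scale a (r *ₚ t)) ((0# ∷ (p *ₚ r)) *ₚ t) (0# ∷ (p *ₚ (r *ₚ t)))
        (scale-*ₚ a r t)
        (λ j → trans (0∷-*ₚ (p *ₚ r) t j) (0∷-cong _ _ (*ₚ-assoc p r t) j)) i)

  eval : Poly → Carrier → Carrier
  eval []      x = 0#
  eval (a ∷ p) x = a + x * eval p x

  eval-+ₚ : ∀ p r x → eval (p +ₚ r) x ≈ eval p x + eval r x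
  eval-+ₚ []      r       x = sym (+-identityˡ _)
  eval-+ₚ (a ∷ p) []      x = sym (+-identityʳ _)
  eval-+ₚ (a ∷ p) (b ∷ r) x =
    trans (+-congˡ (*-congˡ (eval-+ₚ p r x))) (regroup a b x (eval p x) (eval r x))
    where
    regroup : ∀ a b x u v → (a + b) + x * (u + v) ≈ (a + x * u) + (b + x * v)
    regroup = solve 5 (λ a b x u v → (a :+ b) :+ x :* (u :+ v) := (a :+ x :* u) :+ (b :+ x :* v)) refl

  eval-scale : ∀ a p x → eval (scale a p) x ≈ a * eval p x
  eval-scale a []      x = sym (zeroʳ a)
  eval-scale a (b ∷ p) x =
    trans (+-congˡ (*-congˡ (eval-scale a p x))) (regroup a b x (eval p x))
    where
    regroup : ∀ a b x u → a * b + x * (a * u) ≈ a * (b + x * u)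
    regroup = solve 4 (λ a b x u → a :* b :+ x :* (a :* u) := a :* (b :+ x :* u)) refl

  eval-*ₚ : ∀ p r x → eval (p *ₚ r) x ≈ eval p x * eval r x
  eval-*ₚ []      r x = sym (zeroˡ _)
  eval-*ₚ (a ∷ p) r x = begin
    eval (scale a r +ₚ (0# ∷ (p *ₚ r))) x         ≈⟨ eval-+ₚ (scale a r) _ x ⟩
    eval (scale a r) x + (0# + x * eval (p *ₚ r) x)
      ≈⟨ +-cong (eval-scale a r x) (trans (+-identityˡ _) (*-congˡ (eval-*ₚ p r x))) ⟩
    a * eval r x + x * (eval p x * eval r x)      ≈⟨ regroup a x (eval p x) (eval r x) ⟩
    (a + x * eval p x) * eval r x                 ∎
    where
    regroup : ∀ a x u v → a * v + x * (u * v) ≈ (a + x * u) * v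
    regroup = solve 4 (λ a x u v → a :* v :+ x :* (u :* v) := (a :+ x :* u) :* v) refl

  eval-zeroₚ : ∀ p x → p ≋ [] → eval p x ≈ 0#
  eval-zeroₚ []      x p≋[] = refl
  eval-zeroₚ (a ∷ p) x p≋[] = begin
    a + x * eval p x   ≈⟨ +-cong (p≋[] zero) (*-congˡ (eval-zeroₚ p x (λ i → p≋[] (suc i)))) ⟩
    0# + x * 0#        ≈⟨ +-identityˡ _ ⟩
    x * 0#             ≈⟨ zeroʳ x ⟩
    0#                 ∎

  eval-cong : ∀ p r x → p ≋ r → eval p x ≈ eval r x
  eval-cong []      r       x p≋r = sym (eval-zeroₚ r x (λ i → sym (p≋r i)))
  eval-cong (a ∷ p) []      x p≋r = eval-zeroₚ (a ∷ p) x p≋r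
  eval-cong (a ∷ p) (b ∷ r) x p≋r =
    +-cong (p≋r zero) (*-congˡ (eval-cong p r x (λ i → p≋r (suc i))))

  eval-oneₚ : ∀ x → eval oneₚ x ≈ 1#
  eval-oneₚ x = trans (+-congˡ (zeroʳ x)) (+-identityʳ 1#)

  eval-^ₚ : ∀ p m x → eval (p ^ₚ m) x ≈ eval p x ^ m
  eval-^ₚ p zero  x = eval-oneₚ x
  eval-^ₚ p (suc m) x = trans (eval-*ₚ p (p ^ₚ m) x) (*-congˡ (eval-^ₚ p m x))

  eval-∑ₚ : ∀ m (f : Fin m → Poly) x → eval (∑ₚ m f) x ≈ ∑ m (λ i → eval (f i) x)
  eval-∑ₚ zero  f x = refl
  eval-∑ₚ (suc m) f x = trans (eval-+ₚ (f Fin.zero) _ x) (+-congˡ (eval-∑ₚ m _ x))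

  eval-∏ₚ : ∀ m (f : Fin m → Poly) x → eval (∏ₚ m f) x ≈ ∏ m (λ i → eval (f i) x)
  eval-∏ₚ zero  f x = eval-oneₚ x
  eval-∏ₚ (suc m) f x = trans (eval-*ₚ (f Fin.zero) _ x) (*-congˡ (eval-∏ₚ m _ x))

  eval-1−s : ∀ b x → eval (1− b s) x ≈ 1# − x * b
  eval-1−s b x =
    +-congˡ (trans (*-congˡ (trans (+-congˡ (zeroʳ x)) (+-identityʳ _))) (sym (-‿distribʳ-* x b)))

  root-of-divisor : ∀ d p x → d ∣ₚ p → eval d x ≈ 0# → eval p x ≈ 0#
  root-of-divisor d p x (r , d*r≋p) d[x]≈0 = begin
    eval p x              ≈⟨ eval-cong (d *ₚ r) p x d*r≋p ⟨
    eval (d *ₚ r) x       ≈⟨ eval-*ₚ d r x ⟩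
    eval d x * eval r x   ≈⟨ *-congʳ d[x]≈0 ⟩
    0# * eval r x         ≈⟨ zeroˡ _ ⟩
    0#                    ∎

  coeff-1−s*ₚ-zero : ∀ b q → coeff ((1− b s) *ₚ q) 0 ≈ coeff q 0
  coeff-1−s*ₚ-zero b q = begin
    coeff (scale 1# q +ₚ (0# ∷ _)) 0    ≈⟨ coeff-+ₚ (scale 1# q) _ 0 ⟩
    coeff (scale 1# q) 0 + 0#           ≈⟨ +-identityʳ _ ⟩
    coeff (scale 1# q) 0                ≈⟨ coeff-scale 1# q 0 ⟩
    1# * coeff q 0                      ≈⟨ *-identityˡ _ ⟩
    coeff q 0                           ∎

  coeff-1−s*ₚ-suc : ∀ b q i →
    coeff ((1− b s) *ₚ q) (suc i) ≈ coeff q (suc i) + - b * coeff q i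
  coeff-1−s*ₚ-suc b q i =
    trans (coeff-+ₚ (scale 1# q) (0# ∷ (scale (- b) q +ₚ (0# ∷ []))) (suc i))
      (+-cong (trans (coeff-scale 1# q (suc i)) (*-identityˡ _))
              (trans (coeff-+ₚ (scale (- b) q) (0# ∷ []) i)
                     (trans (+-cong (coeff-scale (- b) q i) (coeff-0∷[] i)) (+-identityʳ _))))

  hornerQuotient : Carrier → Poly → Poly
  hornerQuotient a []      = []
  hornerQuotient a (c ∷ p) = eval p a ∷ hornerQuotient a p

  coeff-hornerQuotient : ∀ a p i → coeff (hornerQuotient a p) i ≡ eval (drop (suc i) p) a
  coeff-hornerQuotient a []      i       = ≡.refl
  coeff-hornerQuotient a (c ∷ p) zero  = ≡.refl
  coeff-hornerQuotient a (c ∷ p) (suc i) = coeff-hornerQuotient a p i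

  eval-drop : ∀ a p i → eval (drop i p) a ≈ coeff p i + a * eval (drop (suc i) p) a
  eval-drop a []      zero  = sym (trans (+-congˡ (zeroʳ a)) (+-identityʳ 0#))
  eval-drop a []      (suc i) = sym (trans (+-congˡ (zeroʳ a)) (+-identityʳ 0#))
  eval-drop a (c ∷ p) zero  = refl
  eval-drop a (c ∷ p) (suc i) = eval-drop a p i

  -- The quotient by 1 − b s is read off Horner's scheme at its root a = b⁻¹.
  1−s-∣ₚ : ∀ a b p → a * b ≈ 1# → eval p a ≈ 0# → (1− b s) ∣ₚ p
  1−s-∣ₚ a b p ab≈1 p[a]≈0 = quotient , product≋p
    where
    quotient : Poly
    quotient = scale (- a) (hornerQuotient a p)

    E : ℕ → Carrier
    E i = eval (drop i p) a

    coeff-quotient : ∀ i → coeff quotient i ≈ - (a * E (suc i))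
    coeff-quotient i = begin
      coeff quotient i                      ≈⟨ coeff-scale (- a) (hornerQuotient a p) i ⟩
      - a * coeff (hornerQuotient a p) i    ≡⟨ ≡.cong (- a *_) (coeff-hornerQuotient a p i) ⟩
      - a * E (suc i)                       ≈⟨ -‿distribˡ-* a (E (suc i)) ⟨
      - (a * E (suc i))                     ∎

    b*[a*x]≈x : ∀ x → b * (a * x) ≈ x
    b*[a*x]≈x x = trans (trans (sym (*-assoc b a x)) (*-congʳ (trans (*-comm b a) ab≈1))) (*-identityˡ x)

    -y+[x+y]≈x : ∀ x y → - y + (x + y) ≈ x
    -y+[x+y]≈x x y = begin
      - y + (x + y)   ≈⟨ +-congˡ (+-comm x y) ⟩
      - y + (y + x)   ≈⟨ +-assoc (- y) y x ⟨
      (- y + y) + x   ≈⟨ +-congʳ (-‿inverseˡ y) ⟩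
      0# + x          ≈⟨ +-identityˡ x ⟩
      x               ∎

    product≋p : ((1− b s) *ₚ quotient) ≋ p
    product≋p zero = begin
      coeff ((1− b s) *ₚ quotient) 0   ≈⟨ coeff-1−s*ₚ-zero b quotient ⟩
      coeff quotient 0                 ≈⟨ coeff-quotient 0 ⟩
      - (a * E 1)                      ≈⟨ +-inverseˡ-unique _ _ (trans (sym (eval-drop a p 0)) p[a]≈0) ⟨
      coeff p 0                        ∎
    product≋p (suc i) = begin
      coeff ((1− b s) *ₚ quotient) (suc i)
        ≈⟨ coeff-1−s*ₚ-suc b quotient i ⟩
      coeff quotient (suc i) + - b * coeff quotient i
        ≈⟨ +-cong (coeff-quotient (suc i)) (*-congˡ (coeff-quotient i)) ⟩
      - (a * E (2 ℕ.+ i)) + - b * - (a * E (suc i))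
        ≈⟨ +-congˡ (trans (-x*-y≈x*y b (a * E (suc i))) (b*[a*x]≈x (E (suc i)))) ⟩
      - (a * E (2 ℕ.+ i)) + E (suc i)
        ≈⟨ +-congˡ (eval-drop a p (suc i)) ⟩
      - (a * E (2 ℕ.+ i)) + (coeff p (suc i) + a * E (2 ℕ.+ i))
        ≈⟨ -y+[x+y]≈x (coeff p (suc i)) (a * E (2 ℕ.+ i)) ⟩
      coeff p (suc i) ∎

  distinct-roots⇒∏-1−s-∣ₚ : ∀ m (a b : Fin m → Carrier) →
    (∀ i → a i * b i ≈ 1#) → (∀ i j → a i * b j ≈ 1# → i ≡ j) →
    ∀ p → (∀ i → eval p (a i) ≈ 0#) → ∏ₚ m (λ i → 1− b i s) ∣ₚ p
  distinct-roots⇒∏-1−s-∣ₚ zero  a b ab≈1 distinct p roots = p , *ₚ-identityˡ p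
  distinct-roots⇒∏-1−s-∣ₚ (suc m) a b ab≈1 distinct p roots =
    r , λ i → trans (*ₚ-assoc L L′ r i) (trans (*ₚ-congˡ L (L′ *ₚ r) q L′r≋q i) (Lq≋p i))
    where
    L L′ : Poly
    L = 1− b Fin.zero s
    L′ = ∏ₚ m (λ i → 1− b (Fin.suc i) s)

    L∣p : L ∣ₚ p
    L∣p = 1−s-∣ₚ (a Fin.zero) (b Fin.zero) p (ab≈1 Fin.zero) (roots Fin.zero)
    q : Poly
    q = proj₁ L∣p
    Lq≋p : (L *ₚ q) ≋ p
    Lq≋p = proj₂ L∣p

    L[a]≉0 : ∀ i → ¬ eval L (a (Fin.suc i)) ≈ 0#
    L[a]≉0 i L[a]≈0 = Finₚ.0≢1+n (≡.sym (distinct (Fin.suc i) Fin.zero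
      (1−x≈0⇒x≈1 (trans (sym (eval-1−s (b Fin.zero) (a (Fin.suc i)))) L[a]≈0))))

    q-roots : ∀ i → eval q (a (Fin.suc i)) ≈ 0#
    q-roots i = x*y≈0⇒y≈0 (L[a]≉0 i) (begin
      eval L (a (Fin.suc i)) * eval q (a (Fin.suc i))  ≈⟨ eval-*ₚ L q _ ⟨
      eval (L *ₚ q) (a (Fin.suc i))                    ≈⟨ eval-cong (L *ₚ q) p _ Lq≋p ⟩
      eval p (a (Fin.suc i))                           ≈⟨ roots (Fin.suc i) ⟩
      0#                                               ∎)

    L′∣q : L′ ∣ₚ q
    L′∣q = distinct-roots⇒∏-1−s-∣ₚ m (λ i → a (Fin.suc i)) (λ i → b (Fin.suc i))
             (λ i → ab≈1 (Fin.suc i)) (λ i j e → Finₚ.suc-injective (distinct _ _ e)) q q-roots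
    r : Poly
    r = proj₁ L′∣q
    L′r≋q : (L′ *ₚ r) ≋ q
    L′r≋q = proj₂ L′∣q

module PolylogPade {c ℓ : Level} (K : Field c ℓ) (q : Field.Carrier K)
  (q≉0 : ¬ Field._≈_ K q (Field.0# K)) (q-nonroot : FieldOps.NotRootOfUnity K q) where
  open Field K hiding (zero)
  open FieldOps K
  open FieldProperties K
  open Polynomials K
  open Lemma2Defs K q
  open import Relation.Binary.Reasoning.Setoid setoid
  open import Algebra.Solver.Ring.NaturalCoefficients.Default commutativeSemiring
  open import Algebra.Properties.CommutativeSemigroup *-commutativeSemigroup using (interchange)
  open Data.Fin using (toℕ)

  q⁻¹^n*q^n≈1 : ∀ n → q ⁻¹ ^ n * q ^ n ≈ 1#
  q⁻¹^n*q^n≈1 n = trans (*-comm _ _) (x^n*x⁻¹^n≈1 n q≉0)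

  q⁻¹^m*q^n≈1⇒m≡n : ∀ m n → q ⁻¹ ^ m * q ^ n ≈ 1# → m ≡ n
  q⁻¹^m*q^n≈1⇒m≡n zero  zero  e = ≡.refl
  q⁻¹^m*q^n≈1⇒m≡n zero  (suc n) e = ⊥-elim (q-nonroot n (trans (sym (*-identityˡ _)) e))
  q⁻¹^m*q^n≈1⇒m≡n (suc m) zero  e = ⊥-elim (q-nonroot m (begin
    q ^ suc m                          ≈⟨ *-identityʳ _ ⟨
    q ^ suc m * 1#                     ≈⟨ *-congˡ e ⟨
    q ^ suc m * (q ⁻¹ ^ suc m * 1#)    ≈⟨ *-congˡ (*-identityʳ _) ⟩
    q ^ suc m * q ⁻¹ ^ suc m           ≈⟨ x^n*x⁻¹^n≈1 (suc m) q≉0 ⟩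
    1#                                 ∎))
  q⁻¹^m*q^n≈1⇒m≡n (suc m) (suc n) e = ≡.cong suc (q⁻¹^m*q^n≈1⇒m≡n m n (begin
    q ⁻¹ ^ m * q ^ n                  ≈⟨ *-identityˡ _ ⟨
    1# * (q ⁻¹ ^ m * q ^ n)           ≈⟨ *-congʳ (q⁻¹^n*q^n≈1 1) ⟨
    (q ⁻¹ ^ 1 * q ^ 1) * (q ⁻¹ ^ m * q ^ n)
      ≈⟨ *-congʳ (*-cong (*-identityʳ _) (*-identityʳ _)) ⟩
    (q ⁻¹ * q) * (q ⁻¹ ^ m * q ^ n)   ≈⟨ interchange (q ⁻¹) q _ _ ⟩
    q ⁻¹ ^ suc m * q ^ suc n          ≈⟨ e ⟩
    1#                                ∎))

  q⁻¹^[m+n]*q^n≈q⁻¹^m : ∀ m n → q ⁻¹ ^ (m ℕ.+ n) * q ^ n ≈ q ⁻¹ ^ m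
  q⁻¹^[m+n]*q^n≈q⁻¹^m m n = begin
    q ⁻¹ ^ (m ℕ.+ n) * q ^ n          ≈⟨ *-congʳ (^-homo-* (q ⁻¹) m n) ⟩
    (q ⁻¹ ^ m * q ⁻¹ ^ n) * q ^ n     ≈⟨ *-assoc _ _ _ ⟩
    q ⁻¹ ^ m * (q ⁻¹ ^ n * q ^ n)     ≈⟨ *-congˡ (q⁻¹^n*q^n≈1 n) ⟩
    q ⁻¹ ^ m * 1#                     ≈⟨ *-identityʳ _ ⟩
    q ⁻¹ ^ m                          ∎

  liCoeff-pos : ∀ j {m} → 0 < m → liCoeff j m ≡ q ⁻¹ ^ m * ((1# − q ⁻¹ ^ m) ⁻¹) ^ j
  liCoeff-pos j {suc m} _ = ≡.refl

  module AtCoefficient (A n : ℕ) (p : Fin A → Fin (suc n) → Carrier) {k} (n<k : n < k) where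

    w : Carrier
    w = q ⁻¹ ^ k

    t<k : (t : Fin (suc n)) → toℕ t < k
    t<k t = ℕₚ.≤-<-trans (Finₚ.toℕ≤pred[n] t) n<k

    w*q^t≈q⁻¹^[k∸t] : ∀ t → w * q ^ toℕ t ≈ q ⁻¹ ^ (k ∸ toℕ t)
    w*q^t≈q⁻¹^[k∸t] t =
      ≡.subst (λ e → q ⁻¹ ^ e * q ^ toℕ t ≈ q ⁻¹ ^ (k ∸ toℕ t))
        (ℕₚ.m∸n+n≡m (ℕₚ.<⇒≤ (t<k t))) (q⁻¹^[m+n]*q^n≈q⁻¹^m (k ∸ toℕ t) (toℕ t))

    -- d t is the factor 1 − s q^t of (s;q)_{n+1} at s = q^{-k}.
    d : Fin (suc n) → Carrier
    d t = 1# − q ⁻¹ ^ (k ∸ toℕ t)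

    d≉0 : ∀ t → ¬ d t ≈ 0#
    d≉0 t d≈0 = ℕₚ.<⇒≢ (ℕₚ.m<n⇒0<n∸m (t<k t))
      (≡.sym (q⁻¹^m*q^n≈1⇒m≡n (k ∸ toℕ t) 0 (trans (*-identityʳ _) (1−x≈0⇒x≈1 d≈0))))

    eval-1−q^ts : ∀ t → eval (1− q ^ toℕ t s) w ≈ d t
    eval-1−q^ts t = trans (eval-1−s _ w) (+-congˡ (-‿cong (w*q^t≈q⁻¹^[k∸t] t)))

    -- R(q^{-k}; q), the paper's R(s;q) at s = q^{-k}.
    summand : Fin A → Fin (suc n) → Carrier
    summand J t = (q ^ toℕ t * p J t) * (d t ⁻¹) ^ jOf J

    R : Carrier
    R = ∑ A (λ J → ∑ (suc n) (summand J))

    C : Carrier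
    C = ∏ (suc n) (λ i → d i ^ A)

    C≉0 : ¬ C ≈ 0#
    C≉0 = ∏-≉0 (suc n) _ (λ i → x≉0⇒x^n≉0 A (d≉0 i))

    sumPLiCoeff≈w*R : sumPLiCoeff A n p k ≈ w * R
    sumPLiCoeff≈w*R = begin
      sumPLiCoeff A n p k
        ≈⟨ ∑-cong A (λ J → ∑-cong (suc n) (term J)) ⟩
      ∑ A (λ J → ∑ (suc n) (λ t → w * summand J t))
        ≈⟨ ∑-cong A (λ J → *-distribˡ-∑ (suc n) w (summand J)) ⟨
      ∑ A (λ J → w * ∑ (suc n) (summand J))
        ≈⟨ *-distribˡ-∑ A w _ ⟨
      w * R ∎
      where
      regroup : ∀ a w x y → a * ((w * x) * y) ≈ w * ((x * a) * y)
      regroup = solve 4 (λ a w x y → a :* ((w :* x) :* y) := w :* ((x :* a) :* y)) refl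

      term : ∀ J t → (if toℕ t ℕ.<ᵇ k then p J t * liCoeff (jOf J) (k ∸ toℕ t) else 0#)
                     ≈ w * summand J t
      term J t with toℕ t ℕ.<ᵇ k | ℕₚ.<⇒<ᵇ (t<k t)
      ... | true | _ = begin
        p J t * liCoeff (jOf J) (k ∸ toℕ t)
          ≡⟨ ≡.cong (p J t *_) (liCoeff-pos (jOf J) (ℕₚ.m<n⇒0<n∸m (t<k t))) ⟩
        p J t * (q ⁻¹ ^ (k ∸ toℕ t) * (d t ⁻¹) ^ jOf J)
          ≈⟨ *-congˡ (*-congʳ (w*q^t≈q⁻¹^[k∸t] t)) ⟨
        p J t * ((w * q ^ toℕ t) * (d t ⁻¹) ^ jOf J)
          ≈⟨ regroup (p J t) w (q ^ toℕ t) _ ⟩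
        w * summand J t ∎

    eval-Π≈C*R : eval (Π A n p) w ≈ C * R
    eval-Π≈C*R = begin
      eval (Π A n p) w
        ≈⟨ eval-∑ₚ A _ w ⟩
      ∑ A (λ J → eval (∑ₚ (suc n) (term J)) w)
        ≈⟨ ∑-cong A (λ J → trans (eval-∑ₚ (suc n) (term J) w) (∑-cong (suc n) (eval-term J))) ⟩
      ∑ A (λ J → ∑ (suc n) (λ t → C * summand J t))
        ≈⟨ ∑-cong A (λ J → *-distribˡ-∑ (suc n) C (summand J)) ⟨
      ∑ A (λ J → C * ∑ (suc n) (summand J))
        ≈⟨ *-distribˡ-∑ A C _ ⟨
      C * R ∎
      where
      punctured : Fin (suc n) → Fin (suc n) → Poly
      punctured t i = if toℕ i ℕ.≡ᵇ toℕ t then oneₚ else (1− q ^ toℕ i s) ^ₚ A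

      term : Fin A → Fin (suc n) → Poly
      term J t = scale (q ^ toℕ t * p J t)
                   ((1− q ^ toℕ t s) ^ₚ (A ∸ jOf J) *ₚ ∏ₚ (suc n) (punctured t))

      G : Fin (suc n) → Carrier
      G t = ∏ (suc n) (λ i → if toℕ i ℕ.≡ᵇ toℕ t then 1# else d i ^ A)

      eval-punctured : ∀ t → eval (∏ₚ (suc n) (punctured t)) w ≈ G t
      eval-punctured t = trans (eval-∏ₚ (suc n) (punctured t) w) (∏-cong (suc n) factor)
        where
        factor : ∀ i → eval (punctured t i) w ≈ (if toℕ i ℕ.≡ᵇ toℕ t then 1# else d i ^ A)
        factor i with toℕ i ℕ.≡ᵇ toℕ t
        ... | true  = eval-oneₚ w
        ... | false = trans (eval-^ₚ (1− q ^ toℕ i s) A w) (^-congˡ A (eval-1−q^ts i))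

      d^[A∸j]*G≈C*d⁻¹^j : ∀ J t → d t ^ (A ∸ jOf J) * G t ≈ C * (d t ⁻¹) ^ jOf J
      d^[A∸j]*G≈C*d⁻¹^j J t = begin
        d t ^ (A ∸ j) * G t
          ≈⟨ *-identityʳ _ ⟨
        (d t ^ (A ∸ j) * G t) * 1#
          ≈⟨ *-congˡ (x^n*x⁻¹^n≈1 j (d≉0 t)) ⟨
        (d t ^ (A ∸ j) * G t) * (d t ^ j * (d t ⁻¹) ^ j)
          ≈⟨ regroup (d t ^ (A ∸ j)) (G t) _ _ ⟩
        (G t * (d t ^ (A ∸ j) * d t ^ j)) * (d t ⁻¹) ^ j
          ≈⟨ *-congʳ (*-congˡ (^-homo-* (d t) (A ∸ j) j)) ⟨
        (G t * d t ^ ((A ∸ j) ℕ.+ j)) * (d t ⁻¹) ^ j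
          ≡⟨ ≡.cong (λ e → (G t * d t ^ e) * (d t ⁻¹) ^ j) (ℕₚ.m∸n+n≡m (Finₚ.toℕ<n J)) ⟩
        (G t * d t ^ A) * (d t ⁻¹) ^ j
          ≈⟨ *-congʳ (∏-punctured (suc n) (λ i → d i ^ A) t) ⟩
        C * (d t ⁻¹) ^ j ∎
        where
        j : ℕ
        j = jOf J
        regroup : ∀ a g b c → (a * g) * (b * c) ≈ (g * (a * b)) * c
        regroup = solve 4 (λ a g b c → (a :* g) :* (b :* c) := (g :* (a :* b)) :* c) refl

      eval-term : ∀ J t → eval (term J t) w ≈ C * summand J t
      eval-term J t = begin
        eval (term J t) w
          ≈⟨ eval-scale a (((1− q ^ toℕ t s) ^ₚ (A ∸ jOf J)) *ₚ ∏ₚ (suc n) (punctured t)) w ⟩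
        a * eval ((1− q ^ toℕ t s) ^ₚ (A ∸ jOf J) *ₚ ∏ₚ (suc n) (punctured t)) w
          ≈⟨ *-congˡ (eval-*ₚ ((1− q ^ toℕ t s) ^ₚ (A ∸ jOf J)) (∏ₚ (suc n) (punctured t)) w) ⟩
        a * (eval ((1− q ^ toℕ t s) ^ₚ (A ∸ jOf J)) w * eval (∏ₚ (suc n) (punctured t)) w)
          ≈⟨ *-congˡ (*-cong (trans (eval-^ₚ (1− q ^ toℕ t s) (A ∸ jOf J) w)
                                    (^-congˡ (A ∸ jOf J) (eval-1−q^ts t)))
                             (eval-punctured t)) ⟩
        a * (d t ^ (A ∸ jOf J) * G t)
          ≈⟨ *-congˡ (d^[A∸j]*G≈C*d⁻¹^j J t) ⟩
        a * (C * (d t ⁻¹) ^ jOf J)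
          ≈⟨ x∙yz≈y∙xz a C _ ⟩
        C * (a * (d t ⁻¹) ^ jOf J) ∎
        where
        a : Carrier
        a = q ^ toℕ t * p J t
        open import Algebra.Properties.CommutativeSemigroup *-commutativeSemigroup using (x∙yz≈y∙xz)

    sumPLiCoeff≈0⇔Π-root : (sumPLiCoeff A n p k ≈ 0#) ⇔ (eval (Π A n p) w ≈ 0#)
    sumPLiCoeff≈0⇔Π-root =
      ⇔.trans (x≈z*y⇒[x≈0⇔y≈0] (x≉0⇒x^n≉0 k (x≉0⇒x⁻¹≉0 q≉0)) sumPLiCoeff≈w*R)
              (⇔.sym (x≈z*y⇒[x≈0⇔y≈0] C≉0 eval-Π≈C*R))

  shiftedPoch-root : ∀ n σ (i : Fin σ) → eval (shiftedPoch n σ) (q ⁻¹ ^ (suc n ℕ.+ toℕ i)) ≈ 0#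
  shiftedPoch-root n σ i =
    trans (eval-∏ₚ σ (λ j → 1− q ^ (suc n ℕ.+ toℕ j) s) (q ⁻¹ ^ (suc n ℕ.+ toℕ i)))
      (∏-≈0 σ _ i (trans (eval-1−s _ _) (x≈y⇒x∙y⁻¹≈ε (sym (q⁻¹^n*q^n≈1 (suc n ℕ.+ toℕ i))))))
    where open import Algebra.Properties.Ring ring using (x≈y⇒x∙y⁻¹≈ε)

  roots⇒shiftedPoch-∣ₚ : ∀ n σ P → (∀ (i : Fin σ) → eval P (q ⁻¹ ^ (suc n ℕ.+ toℕ i)) ≈ 0#) →
    shiftedPoch n σ ∣ₚ P
  roots⇒shiftedPoch-∣ₚ n σ =
    distinct-roots⇒∏-1−s-∣ₚ σ (λ i → q ⁻¹ ^ (suc n ℕ.+ toℕ i)) (λ i → q ^ (suc n ℕ.+ toℕ i))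
      (λ i → q⁻¹^n*q^n≈1 (suc n ℕ.+ toℕ i))
      (λ i j e → Finₚ.toℕ-injective (ℕₚ.+-cancelˡ-≡ (suc n) _ _ (q⁻¹^m*q^n≈1⇒m≡n _ _ e)))

  coeffFin-beyond : ∀ n P {k} → n < k → coeffFin n P k ≈ 0#
  coeffFin-beyond n P {k} n<k with k <? suc n
  ... | yes k<1+n = ⊥-elim (ℕₚ.<⇒≱ k<1+n n<k)
  ... | no  _     = refl

  PadeCondition : (A n σ : ℕ) → (Fin A → Fin (suc n) → Carrier) → (Fin (suc n) → Carrier) → Set ℓ
  PadeCondition A n σ p P0 = ∀ k → k < σ ℕ.+ n ℕ.+ 1 → coeffFin n P0 k + sumPLiCoeff A n p k ≈ 0#

  PadeCondition⇒shiftedPoch-∣ₚ-Π : ∀ A n σ p P0 → PadeCondition A n σ p P0 →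
    shiftedPoch n σ ∣ₚ Π A n p
  PadeCondition⇒shiftedPoch-∣ₚ-Π A n σ p P0 vanish = roots⇒shiftedPoch-∣ₚ n σ (Π A n p) λ i →
    Equivalence.to (AtCoefficient.sumPLiCoeff≈0⇔Π-root A n p (n<k i)) (begin
      sumPLiCoeff A n p (k i)                         ≈⟨ +-identityˡ _ ⟨
      0# + sumPLiCoeff A n p (k i)                    ≈⟨ +-congʳ (coeffFin-beyond n P0 (n<k i)) ⟨
      coeffFin n P0 (k i) + sumPLiCoeff A n p (k i)   ≈⟨ vanish (k i) (suc[n]+i<σ+n+1 n σ i) ⟩
      0#                                              ∎)
    where
    k : Fin σ → ℕ
    k i = suc n ℕ.+ toℕ i
    n<k : ∀ i → n < k i
    n<k i = ℕₚ.m≤m+n (suc n) (toℕ i)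

  -- Below z^{n+1} the condition is met by choosing P̄₀ to cancel the coefficients.
  shiftedPoch-∣ₚ-Π⇒PadeCondition : ∀ A n σ p → shiftedPoch n σ ∣ₚ Π A n p →
    PadeCondition A n σ p (λ t → - sumPLiCoeff A n p (toℕ t))
  shiftedPoch-∣ₚ-Π⇒PadeCondition A n σ p sp∣Π k k<σ+n+1 with k <? suc n
  ... | yes k<1+n rewrite Finₚ.toℕ-fromℕ< k<1+n = -‿inverseˡ _
  ... | no  k≮1+n with n<k<σ+n+1⇒k≡suc[n]+i n σ (ℕₚ.≮⇒≥ k≮1+n) k<σ+n+1
  ...   | i , ≡.refl =
    trans (+-identityˡ _)
      (Equivalence.from (AtCoefficient.sumPLiCoeff≈0⇔Π-root A n p (ℕₚ.≮⇒≥ k≮1+n))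
        (root-of-divisor (shiftedPoch n σ) (Π A n p) _ sp∣Π (shiftedPoch-root n σ i)))

lemma2 : {c ℓ : Level} (K : Field c ℓ) →
  let open Field K
      open FieldOps K
  in FieldOps.CharZero K →
     (q : Carrier) → ¬ (q ≈ 0#) → NotRootOfUnity q →
     (A′ n σ : ℕ) → (p : Fin (suc A′) → Fin (suc n) → Carrier) →
     let open Lemma2Defs K q
     in (Σ[ P0 ∈ (Fin (suc n) → Carrier) ]
           (∀ k → k < σ ℕ.+ n ℕ.+ 1 →
             (coeffFin n P0 k + sumPLiCoeff (suc A′) n p k) ≈ 0#))
        ⇔ (shiftedPoch n σ ∣ₚ Π (suc A′) n p)
lemma2 K _ q q≉0 q-nonroot A′ n σ p = mk⇔
  (λ (P0 , vanish) → PadeCondition⇒shiftedPoch-∣ₚ-Π (suc A′) n σ p P0 vanish)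
  (λ sp∣Π → _ , shiftedPoch-∣ₚ-Π⇒PadeCondition (suc A′) n σ p sp∣Π)
  where open PolylogPade K q q≉0 q-nonroot
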